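{- Let $r,s,k$ be positive integers such that $r<s$, $\gcd(r,s)=1$, and $r+s$ divides $k$. Let $t\in\{0,1,\ldots,r+s-1\}$ be the unique integer with $\frac{sk}{r+s}-1+t\equiv0\pmod{r+s}$ and $t'\in\{0,1,\ldots,r+s-1\}$ the unique integer with $\frac{rk}{r+s}-1+t'\equiv 0\pmod{r+s}$. Suppose $n\ge k$, $$n\ge\begin{cases}\left(\frac{rsk}{(r+s)^2}-\frac{r+st}{r+s}\right)k+\frac{sk}{r+s}+t & t\le r,\\ \left(\frac{rsk}{(r+s)^2}-\frac{r+r(r+s-t)}{r+s}\right)k+\frac{sk}{r+s}-(r+s-t) & t>r,\end{cases}$$ and $$n\ge\begin{cases}\left(\frac{rsk}{(r+s)^2}-\frac{s+rt'}{r+s}\right)k+\frac{rk}{r+s}+t' & t'\le s,\\ \left(\frac{rsk}{(r+s)^2}-\frac{s+s(r+s-t')}{r+s}\right)k+\frac{rk}{r+s}-(r+s-t') & t'>s.\end{cases}$$ Then every function $f:[n]\to\{ -r,s\}$ with $f([n])=0$ has a $k$-block $B\subseteq[n]$ with $f(B)=0$.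
   Context: $[n]=\{1,\ldots,n\}$; for $Y\subseteq[n]$, $f(Y)=\sum_{y\in Y}f(y)$. A $k$-block is a set of $k$ consecutive integers. -}

module Defs where

open import Data.Nat using (ℕ; zero; suc; _+_)
open import Data.Integer using (ℤ; 0ℤ) renaming (_+_ to _+ℤ_)

-- blockSum f a j = f(a+1) + f(a+2) + ... + f(a+j)
-- i.e. f(Y) for Y = {a+1, ..., a+j}; a j-block of [n] is {a+1,...,a+j} with a+j ≤ n.
blockSum : (ℕ → ℤ) → ℕ → ℕ → ℤ
blockSum f a zero = 0ℤ
blockSum f a (suc j) = f (suc a) +ℤ blockSum f (suc a) j

sumTo : (ℕ → ℤ) → ℕ → ℤ
sumTo f n = blockSum f 0 n

-- Write R = r + s and k = mR, and let W(x) be the number of values s in the k-block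
-- {x+1, …, x+k}; its sum is R(W(x) − rm). Sliding the block changes W by at most one, so
-- either some block sum vanishes or all block sums have one sign, and replacing f by −f
-- (which exchanges (r, t) with (s, t′)) reduces to the case where all are positive.
-- As f([n]) = 0 and gcd(r, s) = 1, R divides n; write n = (qm + p)R with m = p + w.
-- Covering [n] by an initial segment of length pR followed by q disjoint k-blocks, the
-- positive blocks force q ≤ rp and q + 1 ≤ sw. With sm + t = 1 + cR, the cases p < c and
-- c ≤ p then bound n strictly below the thresholds in the hypotheses.

module Submission where

open import Defs
open import Data.Nat using (ℕ; zero; suc; _+_; _*_; _∸_; _≤_; _<_; s≤s; z≤n; NonZero; >-nonZero; >-nonZero⁻¹)
open import Data.Nat.Properties
open import Data.Nat.Tactic.RingSolver using (solve-∀)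
open import Data.Nat.Divisibility using (_∣_; divides)
open import Data.Nat.DivMod using (_/_; _%_; m≡m%n+[m/n]*n; m%n<n)
open import Data.Nat.GCD using (gcd)
open import Data.Nat.Coprimality using (gcd≡1⇒coprime; coprime-+; coprime-divisor) renaming (sym to coprime-sym)
open import Data.Integer as ℤ using (ℤ; +_; -_; 0ℤ; _⊖_) renaming (_+_ to _+ℤ_; _-_ to _-ℤ_; _*_ to _*ℤ_; _≟_ to _≟ℤ_; _<_ to _<ℤ_; _≤_ to _≤ℤ_)
import Data.Integer.Properties as ℤP
open import Data.Integer.Tactic.RingSolver using () renaming (solve-∀ to ℤ-solve-∀)
open import Data.Bool using (true; false; if_then_else_)
open import Data.Empty using (⊥; ⊥-elim)
open import Data.Product using (∃-syntax; _×_; _,_)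
open import Data.Sum using (_⊎_; inj₁; inj₂)
open import Function using (_∘_)
open import Relation.Nullary using (¬_; does; yes; no)
open import Relation.Nullary.Decidable using (dec-true; dec-false)
open import Relation.Binary using (tri<; tri≈; tri>)
open import Relation.Binary.PropositionalEquality

TwoValued : ℕ → ℕ → ℕ → (ℕ → ℤ) → Set
TwoValued r s n f = ∀ i → 1 ≤ i → i ≤ n → f i ≡ - (+ r) ⊎ f i ≡ + s

occurs : (ℕ → ℤ) → ℤ → ℕ → ℕ
occurs f v i = if does (f i ≟ℤ v) then 1 else 0

count : (ℕ → ℤ) → ℤ → ℕ → ℕ → ℕ
count f v a zero    = 0
count f v a (suc j) = occurs f v (suc a) + count f v (suc a) j

occurs≤1 : ∀ f v i → occurs f v i ≤ 1
occurs≤1 f v i with does (f i ≟ℤ v)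
... | true  = ≤-refl
... | false = z≤n

occurs-hit : ∀ {f v i} → f i ≡ v → occurs f v i ≡ 1
occurs-hit {f} {v} {i} eq rewrite dec-true (f i ≟ℤ v) eq = refl

occurs-miss : ∀ {f v i} → f i ≢ v → occurs f v i ≡ 0
occurs-miss {f} {v} {i} ne rewrite dec-false (f i ≟ℤ v) ne = refl

count-++ : ∀ f v a i j → count f v a (i + j) ≡ count f v a i + count f v (a + i) j
count-++ f v a zero    j rewrite +-identityʳ a = refl
count-++ f v a (suc i) j rewrite count-++ f v (suc a) i j | +-suc a i =
  sym (+-assoc (occurs f v (suc a)) _ _)

count-snoc : ∀ f v a j → count f v a (suc j) ≡ count f v a j + occurs f v (suc (a + j))
count-snoc f v a j = begin
  count f v a (suc j)                              ≡⟨ cong (count f v a) (+-comm 1 j) ⟩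
  count f v a (j + 1)                              ≡⟨ count-++ f v a j 1 ⟩
  count f v a j + (occurs f v (suc (a + j)) + 0)   ≡⟨ cong (λ x → count f v a j + x) (+-identityʳ _) ⟩
  count f v a j + occurs f v (suc (a + j))         ∎
  where open ≡-Reasoning

count-slideʳ : ∀ f v a j → count f v (suc a) j ≤ suc (count f v a j)
count-slideʳ f v a j = begin
  count f v (suc a) j                            ≤⟨ m≤n+m _ (occurs f v (suc a)) ⟩
  count f v a (suc j)                            ≡⟨ count-snoc f v a j ⟩
  count f v a j + occurs f v (suc (a + j))       ≤⟨ +-monoʳ-≤ (count f v a j) (occurs≤1 f v _) ⟩
  count f v a j + 1                              ≡⟨ +-comm _ 1 ⟩
  suc (count f v a j)                            ∎
  where open ≤-Reasoning

count-slideˡ : ∀ f v a j → count f v a j ≤ suc (count f v (suc a) j)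
count-slideˡ f v a j = begin
  count f v a j                              ≤⟨ m≤m+n _ _ ⟩
  count f v a j + occurs f v (suc (a + j))   ≡⟨ count-snoc f v a j ⟨
  count f v a (suc j)                        ≤⟨ +-monoˡ-≤ _ (occurs≤1 f v (suc a)) ⟩
  suc (count f v (suc a) j)                  ∎
  where open ≤-Reasoning

count≤length : ∀ f v a j → count f v a j ≤ j
count≤length f v a zero    = z≤n
count≤length f v a (suc j) = +-mono-≤ (occurs≤1 f v (suc a)) (count≤length f v (suc a) j)

count-concat-≥ : ∀ {f v k n L} → (∀ x → x + k ≤ n → L ≤ count f v x k) →
  ∀ j x → x + j * k ≤ n → j * L ≤ count f v x (j * k)
count-concat-≥ windows zero    x _ = z≤n
count-concat-≥ {f} {v} {k} {n} {L} windows (suc j) x x+k+jk≤n = begin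
  L + j * L                              ≤⟨ +-mono-≤ (windows x (≤-trans (m≤m+n (x + k) _) rest≤n))
                                                     (count-concat-≥ windows j (x + k) rest≤n) ⟩
  count f v x k + count f v (x + k) (j * k) ≡⟨ count-++ f v x k (j * k) ⟨
  count f v x (k + j * k)                ∎
  where
  open ≤-Reasoning
  rest≤n : x + k + j * k ≤ n
  rest≤n = subst (_≤ n) (sym (+-assoc x k (j * k))) x+k+jk≤n

neg≢+suc : ∀ r s → - (+ r) ≢ + suc s
neg≢+suc zero    s ()
neg≢+suc (suc r) s ()

shifted-value : ∀ {r s n f} → 0 < s → TwoValued r s n f → ∀ i → 1 ≤ i → i ≤ n →
  f i +ℤ + r ≡ + ((r + s) * occurs f (+ s) i)
shifted-value {r} {suc s} {f = f} 0<s two i 1≤i i≤n with two i 1≤i i≤n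
... | inj₁ f≡-r = begin
  f i +ℤ + r                         ≡⟨ cong (_+ℤ + r) f≡-r ⟩
  - (+ r) +ℤ + r                     ≡⟨ ℤP.+-inverseˡ (+ r) ⟩
  + 0                                ≡⟨ cong +_ (*-zeroʳ (r + suc s)) ⟨
  + ((r + suc s) * 0)                ≡⟨ cong (λ x → + ((r + suc s) * x)) (occurs-miss {f} { + suc s} {i} -r≢s) ⟨
  + ((r + suc s) * occurs f _ i)     ∎
  where
  open ≡-Reasoning
  -r≢s : f i ≢ + suc s
  -r≢s f≡s = neg≢+suc r s (trans (sym f≡-r) f≡s)
... | inj₂ f≡s = begin
  f i +ℤ + r                         ≡⟨ cong (_+ℤ + r) f≡s ⟩
  + suc s +ℤ + r                     ≡⟨ ℤP.pos-+ (suc s) r ⟨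
  + (suc s + r)                      ≡⟨ cong +_ (trans (+-comm (suc s) r) (sym (*-identityʳ _))) ⟩
  + ((r + suc s) * 1)                ≡⟨ cong (λ x → + ((r + suc s) * x)) (occurs-hit {f} { + suc s} {i} f≡s) ⟨
  + ((r + suc s) * occurs f _ i)     ∎
  where open ≡-Reasoning

blockSum-count : ∀ {r s n f} → 0 < s → TwoValued r s n f → ∀ a j → a + j ≤ n →
  blockSum f a j +ℤ + (r * j) ≡ + ((r + s) * count f (+ s) a j)
blockSum-count {r} {s} _ two a zero _ rewrite *-zeroʳ r | *-zeroʳ (r + s) = refl
blockSum-count {r} {s} {n} {f} 0<s two a (suc j) a+1+j≤n = begin
  (f (suc a) +ℤ B) +ℤ + (r * suc j)        ≡⟨ cong ((f (suc a) +ℤ B) +ℤ_) r[1+j] ⟩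
  (f (suc a) +ℤ B) +ℤ (+ r +ℤ + (r * j))   ≡⟨ interchange (f (suc a)) B (+ r) (+ (r * j)) ⟩
  (f (suc a) +ℤ + r) +ℤ (B +ℤ + (r * j))   ≡⟨ cong₂ _+ℤ_ head rest ⟩
  + (R * H) +ℤ + (R * T)                   ≡⟨ ℤP.pos-+ (R * H) (R * T) ⟨
  + (R * H + R * T)                        ≡⟨ cong +_ (*-distribˡ-+ R H T) ⟨
  + (R * count f (+ s) a (suc j))          ∎
  where
  open ≡-Reasoning
  R = r + s
  B = blockSum f (suc a) j
  H = occurs f (+ s) (suc a)
  T = count f (+ s) (suc a) j
  a+j<n : suc (a + j) ≤ n
  a+j<n = subst (_≤ n) (+-suc a j) a+1+j≤n
  r[1+j] : + (r * suc j) ≡ + r +ℤ + (r * j)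
  r[1+j] = trans (cong +_ (*-suc r j)) (ℤP.pos-+ r (r * j))
  head : f (suc a) +ℤ + r ≡ + (R * H)
  head = shifted-value 0<s two (suc a) (s≤s z≤n) (≤-trans (s≤s (m≤m+n a j)) a+j<n)
  rest : B +ℤ + (r * j) ≡ + (R * T)
  rest = blockSum-count 0<s two (suc a) j a+j<n
  interchange : ∀ x y z w → (x +ℤ y) +ℤ (z +ℤ w) ≡ (x +ℤ z) +ℤ (y +ℤ w)
  interchange = ℤ-solve-∀

blockSum-neg : ∀ f a j → blockSum (λ i → - f i) a j ≡ - blockSum f a j
blockSum-neg f a zero    = refl
blockSum-neg f a (suc j) = trans (cong (- f (suc a) +ℤ_) (blockSum-neg f (suc a) j))
                                 (sym (ℤP.neg-distrib-+ (f (suc a)) (blockSum f (suc a) j)))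

TwoValued-neg : ∀ {r s n f} → TwoValued r s n f → TwoValued s r n (λ i → - f i)
TwoValued-neg {r} two i 1≤i i≤n with two i 1≤i i≤n
... | inj₁ f≡-r = inj₂ (trans (cong -_ f≡-r) (ℤP.neg-involutive (+ r)))
... | inj₂ f≡s  = inj₁ (cong -_ f≡s)

balanced-count : ∀ {r s n f} → 0 < s → TwoValued r s n f → sumTo f n ≡ 0ℤ →
  r * n ≡ (r + s) * count f (+ s) 0 n
balanced-count {r} {n = n} {f} 0<s two sum≡0 = ℤP.+-injective (begin
  + (r * n)                  ≡⟨ cong (_+ℤ + (r * n)) sum≡0 ⟨
  sumTo f n +ℤ + (r * n)     ≡⟨ blockSum-count 0<s two 0 n ≤-refl ⟩
  + _                        ∎)
  where open ≡-Reasoning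

length-divisible : ∀ {r s n f} → 0 < s → gcd r s ≡ 1 → TwoValued r s n f → sumTo f n ≡ 0ℤ → (r + s) ∣ n
length-divisible {r} {s} {n} {f} 0<s gcd≡1 two sum≡0 =
  coprime-divisor (coprime-+ (coprime-sym (gcd≡1⇒coprime {r} {s} gcd≡1)))
    (divides (count f (+ s) 0 n) (trans (balanced-count 0<s two sum≡0) (*-comm (r + s) _)))

block-decomposition : ∀ {R n} m → 0 < m * R → R ∣ n →
  ∃[ q ] ∃[ p ] ∃[ w ] (m ≡ p + w × n ≡ (q * m + p) * R)
block-decomposition {R} m 0<mR (divides N refl) =
  N / m , N % m , m ∸ N % m , sym (m+[n∸m]≡n (<⇒≤ (m%n<n N m))) ,
  cong (_* R) (trans (m≡m%n+[m/n]*n N m) (+-comm (N % m) _))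
  where
  instance
    m≢0 : NonZero m
    m≢0 = m*n≢0⇒m≢0 m {{>-nonZero 0<mR}}

⊖-from-shift : ∀ {x u v} → x +ℤ + u ≡ + v → x ≡ v ⊖ u
⊖-from-shift {x} {u} {v} eq = begin
  x                          ≡⟨ undo x (+ u) ⟩
  (x +ℤ + u) +ℤ - (+ u)      ≡⟨ cong (_+ℤ - (+ u)) eq ⟩
  + v +ℤ - (+ u)             ≡⟨ ℤP.m-n≡m⊖n v u ⟩
  v ⊖ u                      ∎
  where
  open ≡-Reasoning
  undo : ∀ x y → x ≡ (x +ℤ y) +ℤ - y
  undo = ℤ-solve-∀

window-sum : ∀ {r s n f} → 0 < s → TwoValued r s n f → ∀ m x → x + m * (r + s) ≤ n →
  blockSum f x (m * (r + s)) ≡ ((r + s) * count f (+ s) x (m * (r + s))) ⊖ ((r + s) * (r * m))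
window-sum {r} {s} {f = f} 0<s two m x le = ⊖-from-shift (begin
  blockSum f x k +ℤ + ((r + s) * (r * m))   ≡⟨ cong (λ u → blockSum f x k +ℤ + u) (regroup r s m) ⟨
  blockSum f x k +ℤ + (r * k)               ≡⟨ blockSum-count 0<s two x k le ⟩
  + _                                       ∎)
  where
  open ≡-Reasoning
  k = m * (r + s)
  regroup : ∀ r s m → r * (m * (r + s)) ≡ (r + s) * (r * m)
  regroup = solve-∀

⊖-positive : ∀ {m n} → n < m → 0ℤ <ℤ m ⊖ n
⊖-positive n<m rewrite ℤP.⊖-≥ (<⇒≤ n<m) = ℤ.+<+ (m<n⇒0<n∸m n<m)

⊖-negative : ∀ {m n} → m < n → m ⊖ n <ℤ 0ℤ
⊖-negative {m} {n} m<n rewrite ℤP.⊖-swap m n = ℤP.neg-mono-< (⊖-positive m<n)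

⊖-positive⁻¹ : ∀ {m n} → 0ℤ <ℤ m ⊖ n → n < m
⊖-positive⁻¹ {m} {n} 0<m⊖n with n <? m
... | yes n<m = n<m
... | no  n≮m = ⊥-elim (ℤP.<⇒≱ 0<m⊖n (subst (_≤ℤ 0ℤ) (sym (ℤP.⊖-≤ (≮⇒≥ n≮m))) ℤP.neg-≤-pos))

extend-≤ : ∀ {P : ℕ → Set} {N} → (∀ x → x ≤ N → P x) → P (suc N) → ∀ x → x ≤ suc N → P x
extend-≤ below top x x≤1+N with m≤n⇒m<n∨m≡n x≤1+N
... | inj₁ x<1+N = below x (≤-pred x<1+N)
... | inj₂ refl  = top

discrete-ivt : ∀ (W : ℕ → ℕ) Z → (∀ x → W x ≤ suc (W (suc x))) → (∀ x → W (suc x) ≤ suc (W x)) → ∀ N →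
  (∃[ x ] x ≤ N × W x ≡ Z) ⊎ (∀ x → x ≤ N → Z < W x) ⊎ (∀ x → x ≤ N → W x < Z)
discrete-ivt W Z down up zero with <-cmp (W 0) Z
... | tri< W<Z _ _ = inj₂ (inj₂ λ { zero _ → W<Z })
... | tri≈ _ W≡Z _ = inj₁ (0 , z≤n , W≡Z)
... | tri> _ _ Z<W = inj₂ (inj₁ λ { zero _ → Z<W })
discrete-ivt W Z down up (suc N) with discrete-ivt W Z down up N
... | inj₁ (x , x≤N , hit) = inj₁ (x , m≤n⇒m≤1+n x≤N , hit)
... | inj₂ (inj₁ above) with W (suc N) ≟ Z
...   | yes hit  = inj₁ (suc N , ≤-refl , hit)
...   | no  miss =
  inj₂ (inj₁ (extend-≤ above (≤∧≢⇒< (≤-pred (≤-trans (above N ≤-refl) (down N))) (miss ∘ sym))))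
discrete-ivt W Z down up (suc N) | inj₂ (inj₂ below) with W (suc N) ≟ Z
...   | yes hit  = inj₁ (suc N , ≤-refl , hit)
...   | no  miss = inj₂ (inj₂ (extend-≤ below (≤∧≢⇒< (≤-trans (up N) (below N ≤-refl)) miss)))

window-trichotomy : ∀ {r s n f} m → 0 < s → TwoValued r s n f → m * (r + s) ≤ n →
    (∃[ x ] x + m * (r + s) ≤ n × blockSum f x (m * (r + s)) ≡ 0ℤ)
  ⊎ (∀ x → x + m * (r + s) ≤ n → 0ℤ <ℤ blockSum f x (m * (r + s)))
  ⊎ (∀ x → x + m * (r + s) ≤ n → blockSum f x (m * (r + s)) <ℤ 0ℤ)
window-trichotomy {r} {s} {n} {f} m 0<s two k≤n =
  classify (discrete-ivt W (r * m) (λ x → count-slideˡ f (+ s) x k) (λ x → count-slideʳ f (+ s) x k) (n ∸ k))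
  where
  R = r + s
  k = m * R
  W : ℕ → ℕ
  W x = count f (+ s) x k
  instance
    R≢0 : NonZero R
    R≢0 = >-nonZero (≤-trans 0<s (m≤n+m s r))
  windowed : ∀ {x} → x ≤ n ∸ k → blockSum f x k ≡ (R * W x) ⊖ (R * (r * m))
  windowed x≤n-k = window-sum 0<s two m _ (m≤o∸n⇒m+n≤o _ k≤n x≤n-k)
  classify : (∃[ x ] x ≤ n ∸ k × W x ≡ r * m)
           ⊎ (∀ x → x ≤ n ∸ k → r * m < W x)
           ⊎ (∀ x → x ≤ n ∸ k → W x < r * m) →
      (∃[ x ] x + k ≤ n × blockSum f x k ≡ 0ℤ)
    ⊎ (∀ x → x + k ≤ n → 0ℤ <ℤ blockSum f x k)
    ⊎ (∀ x → x + k ≤ n → blockSum f x k <ℤ 0ℤ)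
  classify (inj₁ (x , x≤n-k , balanced)) =
    inj₁ (x , m≤o∸n⇒m+n≤o x k≤n x≤n-k , (begin
      blockSum f x k                 ≡⟨ windowed x≤n-k ⟩
      (R * W x) ⊖ (R * (r * m))      ≡⟨ cong (λ w → (R * w) ⊖ (R * (r * m))) balanced ⟩
      (R * (r * m)) ⊖ (R * (r * m))  ≡⟨ ℤP.n⊖n≡0 (R * (r * m)) ⟩
      0ℤ                             ∎))
    where open ≡-Reasoning
  classify (inj₂ (inj₁ heavy)) = inj₂ (inj₁ λ x x+k≤n → let x≤n-k = m+n≤o⇒m≤o∸n x x+k≤n in
    subst (0ℤ <ℤ_) (sym (windowed x≤n-k)) (⊖-positive (*-monoʳ-< R (heavy x x≤n-k))))
  classify (inj₂ (inj₂ light)) = inj₂ (inj₂ λ x x+k≤n → let x≤n-k = m+n≤o⇒m≤o∸n x x+k≤n in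
    subst (_<ℤ 0ℤ) (sym (windowed x≤n-k)) (⊖-negative (*-monoʳ-< R (light x x≤n-k))))

covering-bounds : ∀ a b p w q C →
  C + q * suc (a * (p + w)) ≤ a * (q * (p + w) + p) → suc (a * (p + w)) ≤ C + w * (a + b) →
  q ≤ a * p × suc q ≤ b * w
covering-bounds a b p w q C covered first = q≤ap , +-cancelˡ-≤ (a * p + a * w) (suc q) (b * w) (begin
  a * p + a * w + suc q    ≡⟨ regroup₂ a p w q ⟩
  suc (a * (p + w)) + q    ≤⟨ +-monoˡ-≤ q first ⟩
  C + w * (a + b) + q      ≡⟨ regroup₃ C w a b q ⟩
  (C + q) + w * (a + b)    ≤⟨ +-monoˡ-≤ (w * (a + b)) C+q≤ap ⟩
  a * p + w * (a + b)      ≡⟨ regroup₄ a p w b ⟩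
  a * p + a * w + b * w    ∎)
  where
  open ≤-Reasoning
  regroup₁ : ∀ C q a m → C + q * suc (a * m) ≡ (C + q) + q * (a * m)
  regroup₁ = solve-∀
  regroup₂ : ∀ a p w q → a * p + a * w + suc q ≡ suc (a * (p + w)) + q
  regroup₂ = solve-∀
  regroup₃ : ∀ C w a b q → C + w * (a + b) + q ≡ (C + q) + w * (a + b)
  regroup₃ = solve-∀
  regroup₄ : ∀ a p w b → a * p + w * (a + b) ≡ a * p + a * w + b * w
  regroup₄ = solve-∀
  regroup₅ : ∀ a q m p → a * (q * m + p) ≡ a * p + q * (a * m)
  regroup₅ = solve-∀
  C+q≤ap : C + q ≤ a * p
  C+q≤ap = +-cancelʳ-≤ (q * (a * (p + w))) (C + q) (a * p)
             (subst₂ _≤_ (regroup₁ C q a (p + w)) (regroup₅ a q (p + w) p) covered)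
  q≤ap : q ≤ a * p
  q≤ap = ≤-trans (m≤n+m q C) C+q≤ap

positive-windows⇒bounds : ∀ {a b n f} m q p w → 0 < b → TwoValued a b n f → sumTo f n ≡ 0ℤ →
  m ≡ p + w → n ≡ (q * m + p) * (a + b) → m * (a + b) ≤ n →
  (∀ x → x + m * (a + b) ≤ n → 0ℤ <ℤ blockSum f x (m * (a + b))) →
  q ≤ a * p × suc q ≤ b * w
positive-windows⇒bounds {a} {b} {n} {f} m q p w 0<b two sum≡0 refl refl k≤n positive =
  covering-bounds a b p w q (C ρ) covered first
  where
  R = a + b
  k = m * R
  ρ = p * R
  C : ℕ → ℕ
  C = count f (+ b) 0
  instance
    R≢0 : NonZero R
    R≢0 = >-nonZero (≤-trans 0<b (m≤n+m b a))
  heavy : ∀ x → x + k ≤ n → suc (a * m) ≤ count f (+ b) x k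
  heavy x x+k≤n = *-cancelˡ-< R _ _ (⊖-positive⁻¹ (subst (0ℤ <ℤ_) (window-sum 0<b two m x x+k≤n) (positive x x+k≤n)))
  n≡ρ+qk : n ≡ ρ + q * k
  n≡ρ+qk = regroup q p w R
    where
    regroup : ∀ q p w R → (q * (p + w) + p) * R ≡ p * R + q * ((p + w) * R)
    regroup = solve-∀
  k≡ρ+wR : k ≡ ρ + w * R
  k≡ρ+wR = *-distribʳ-+ R p w
  total : C n ≡ a * (q * m + p)
  total = *-cancelˡ-≡ _ _ R (trans (sym (balanced-count 0<b two sum≡0)) (regroup a (q * m + p) R))
    where
    regroup : ∀ a x R → a * (x * R) ≡ R * (a * x)
    regroup = solve-∀
  covered : C ρ + q * suc (a * m) ≤ a * (q * m + p)
  covered = begin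
    C ρ + q * suc (a * m)           ≤⟨ +-monoʳ-≤ (C ρ) (count-concat-≥ heavy q ρ (≤-reflexive (sym n≡ρ+qk))) ⟩
    C ρ + count f (+ b) ρ (q * k)   ≡⟨ count-++ f (+ b) 0 ρ (q * k) ⟨
    C (ρ + q * k)                   ≡⟨ cong C n≡ρ+qk ⟨
    C n                             ≡⟨ total ⟩
    a * (q * m + p)                 ∎
    where open ≤-Reasoning
  first : suc (a * m) ≤ C ρ + w * R
  first = begin
    suc (a * m)                     ≤⟨ heavy 0 k≤n ⟩
    C k                             ≡⟨ cong C k≡ρ+wR ⟩
    C (ρ + w * R)                   ≡⟨ count-++ f (+ b) 0 ρ (w * R) ⟩
    C ρ + count f (+ b) ρ (w * R)   ≤⟨ +-monoʳ-≤ (C ρ) (count≤length f (+ b) ρ (w * R)) ⟩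
    C ρ + w * R                     ∎
    where open ≤-Reasoning

-- The bounds on n in the cases p < c and c ≤ p, where b m + t = 1 + c (a + b).
LengthBound : ℕ → ℕ → ℕ → ℕ → ℕ → Set
LengthBound a b m t n =
    n + suc (a + b) * (a * m + 1) ≤ (b * m + t) * (a * m + 1)
  ⊎ n + (a * m + 1 + t * (b * m)) ≤ (a * m + 1) * (b * m) + t

counterexample-length : ∀ a b q p w t c → q ≤ a * p → suc q ≤ b * w →
  b * (p + w) + t ≡ suc (c * (a + b)) → LengthBound a b (p + w) t ((q * (p + w) + p) * (a + b))
counterexample-length a b q p w t c q≤ap q<bw bm+t≡ with p <? c
... | yes p<c = inj₁ (begin
  (q * m + p) * R + suc R * (a * m + 1)   ≡⟨ regroup₁ q m p R a ⟩
  R * (q * m + p + (a * m + 1)) + (a * m + 1) ≤⟨ +-monoˡ-≤ (a * m + 1) (*-monoʳ-≤ R below-c) ⟩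
  R * (c * (a * m + 1)) + (a * m + 1)      ≡⟨ regroup₂ R c a m ⟩
  suc (c * R) * (a * m + 1)                ≡⟨ cong (_* (a * m + 1)) bm+t≡ ⟨
  (b * m + t) * (a * m + 1)                ∎)
  where
  open ≤-Reasoning
  m = p + w
  R = a + b
  regroup₁ : ∀ q m p R a → (q * m + p) * R + suc R * (a * m + 1) ≡ R * (q * m + p + (a * m + 1)) + (a * m + 1)
  regroup₁ = solve-∀
  regroup₂ : ∀ R c a m → R * (c * (a * m + 1)) + (a * m + 1) ≡ suc (c * R) * (a * m + 1)
  regroup₂ = solve-∀
  below-c : q * m + p + (a * m + 1) ≤ c * (a * m + 1)
  below-c = begin
    q * m + p + (a * m + 1)       ≤⟨ +-monoˡ-≤ (a * m + 1) (+-monoˡ-≤ p (*-monoˡ-≤ m q≤ap)) ⟩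
    a * p * m + p + (a * m + 1)   ≡⟨ regroup₃ a p m ⟩
    suc p * (a * m + 1)           ≤⟨ *-monoˡ-≤ (a * m + 1) p<c ⟩
    c * (a * m + 1)               ∎
    where
    regroup₃ : ∀ a p m → a * p * m + p + (a * m + 1) ≡ suc p * (a * m + 1)
    regroup₃ = solve-∀
... | no p≮c with m≤n⇒∃[o]m+o≡n (≮⇒≥ p≮c)
...   | d , refl = inj₂ (begin
  n + (a * m + 1 + t * (b * m))       ≡⟨ cong (λ x → n + (x + t * (b * m))) Y+t≡ ⟨
  n + (Y + t + t * (b * m))           ≡⟨ regroup₁ n Y t (b * m) ⟩
  (n + Y) + t + t * (b * m)           ≤⟨ +-monoˡ-≤ (t * (b * m)) (+-monoˡ-≤ t n+Y≤) ⟩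
  Y * (b * m) + t + t * (b * m)       ≡⟨ regroup₂ Y t (b * m) ⟩
  (Y + t) * (b * m) + t               ≡⟨ cong (λ x → x * (b * m) + t) Y+t≡ ⟩
  (a * m + 1) * (b * m) + t           ∎)
  where
  open ≤-Reasoning
  m = c + d + w
  R = a + b
  n = (q * m + (c + d)) * R
  Y = (d + w) * R
  regroup₁ : ∀ n Y t x → n + (Y + t + t * x) ≡ (n + Y) + t + t * x
  regroup₁ = solve-∀
  regroup₂ : ∀ Y t x → Y * x + t + t * x ≡ (Y + t) * x + t
  regroup₂ = solve-∀
  regroup₃ : ∀ a b c d w → (d + w) * (a + b) + suc (c * (a + b)) ≡ a * (c + d + w) + 1 + b * (c + d + w)
  regroup₃ = solve-∀
  Y+t≡ : Y + t ≡ a * m + 1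
  Y+t≡ = +-cancelʳ-≡ (b * m) (Y + t) (a * m + 1) (begin-equality
    Y + t + b * m               ≡⟨ +-assoc Y t (b * m) ⟩
    Y + (t + b * m)             ≡⟨ cong (λ x → Y + x) (+-comm t (b * m)) ⟩
    Y + (b * m + t)             ≡⟨ cong (λ x → Y + x) bm+t≡ ⟩
    Y + suc (c * R)             ≡⟨ regroup₃ a b c d w ⟩
    a * m + 1 + b * m           ∎)
  n+Y≤ : n + Y ≤ Y * (b * m)
  n+Y≤ = begin
    n + Y                             ≡⟨ *-distribʳ-+ R (q * m + (c + d)) (d + w) ⟨
    (q * m + (c + d) + (d + w)) * R   ≡⟨ cong (_* R) (regroup₄ q c d w) ⟩
    (suc q * m + d) * R               ≤⟨ *-monoˡ-≤ R (+-mono-≤ (*-monoˡ-≤ m q<bw) d≤dbm) ⟩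
    (b * w * m + d * (b * m)) * R     ≡⟨ regroup₅ b w m d R ⟩
    Y * (b * m)                       ∎
    where
    1≤bm : 1 ≤ b * m
    1≤bm = ≤-trans (≤-trans (s≤s z≤n) q<bw) (*-monoʳ-≤ b (m≤n+m w (c + d)))
    d≤dbm : d ≤ d * (b * m)
    d≤dbm = ≤-trans (≤-reflexive (sym (*-identityʳ d))) (*-monoʳ-≤ d 1≤bm)
    regroup₄ : ∀ q c d w → q * (c + d + w) + (c + d) + (d + w) ≡ suc q * (c + d + w) + d
    regroup₄ = solve-∀
    regroup₅ : ∀ b w m d R → (b * w * m + d * (b * m)) * R ≡ (d + w) * R * (b * m)
    regroup₅ = solve-∀

offset-< : ∀ {n E L x y} → n + x ≤ y → y + suc E ≤ L + x → n + E < L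
offset-< {n} {E} {L} {x} {y} n+x≤y y+E<L+x = +-cancelʳ-≤ x (suc (n + E)) L (begin
  suc (n + E) + x    ≡⟨ regroup n E x ⟩
  n + x + suc E      ≤⟨ +-monoˡ-≤ (suc E) n+x≤y ⟩
  y + suc E          ≤⟨ y+E<L+x ⟩
  L + x              ∎)
  where
  open ≤-Reasoning
  regroup : ∀ n E x → suc (n + E) + x ≡ n + x + suc E
  regroup = solve-∀

low-threshold-exceeds : ∀ {a b m t n} → t ≤ a → LengthBound a b m t n →
  n + (a + b * t) * m < a * b * m * m + b * m + t
low-threshold-exceeds {a} {b} {m} {t} t≤a bound with m≤n⇒∃[o]m+o≡n t≤a | bound
... | e , refl | inj₁ below =
  offset-< below (≤-trans (m≤m+n _ ((a + b) * e * m + (a + b))) (≤-reflexive (expand t e b m)))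
  where
  expand : ∀ t e b m →
    (b * m + t) * ((t + e) * m + 1) + suc ((t + e + b * t) * m) + ((t + e + b) * e * m + (t + e + b))
      ≡ (t + e) * b * m * m + b * m + t + suc (t + e + b) * ((t + e) * m + 1)
  expand = solve-∀
... | _ , refl | inj₂ below = offset-< below (≤-reflexive (expand a b m t))
  where
  expand : ∀ a b m t →
    (a * m + 1) * (b * m) + t + suc ((a + b * t) * m)
      ≡ a * b * m * m + b * m + t + (a * m + 1 + t * (b * m))
  expand = solve-∀

high-threshold-exceeds : ∀ {a b m t T n} → T + t ≡ a + b → a < t → 0 < m → LengthBound a b m t n →
  n + ((a + a * T) * m + T) < a * b * m * m + b * m
high-threshold-exceeds {a} {b} {suc m} {t} {T} {n} T+t≡a+b a<t _ bound with m≤n⇒∃[o]m+o≡n a<t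
... | e , refl with b≡T+1+e T+t≡a+b
  where
  b≡T+1+e : T + (suc a + e) ≡ a + b → b ≡ T + suc e
  b≡T+1+e eq = sym (+-cancelˡ-≡ a _ _ (trans (regroup a T e) eq))
    where
    regroup : ∀ a T e → a + (T + suc e) ≡ T + (suc a + e)
    regroup = solve-∀
... | refl = exceeds bound
  where
  exceeds : LengthBound a b (suc m) t n → n + ((a + a * T) * suc m + T) < a * b * suc m * suc m + b * suc m
  exceeds (inj₁ below) = offset-< {n} below (≤-reflexive (expand a T e m))
    where
    expand : ∀ a T e m →
      ((T + suc e) * suc m + (suc a + e)) * (a * suc m + 1) + suc ((a + a * T) * suc m + T)
        ≡ a * (T + suc e) * suc m * suc m + (T + suc e) * suc m + suc (a + (T + suc e)) * (a * suc m + 1)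
    expand = solve-∀
  exceeds (inj₂ below) =
    offset-< {n} below (≤-trans (m≤m+n _ ((a + b) * (e + m + m * e))) (≤-reflexive (expand a T e m)))
    where
    expand : ∀ a T e m →
      (a * suc m + 1) * ((T + suc e) * suc m) + (suc a + e) + suc ((a + a * T) * suc m + T)
        + (a + (T + suc e)) * (e + m + m * e)
        ≡ a * (T + suc e) * suc m * suc m + (T + suc e) * suc m
          + (a * suc m + 1 + (suc a + e) * ((T + suc e) * suc m))
    expand = solve-∀

clear-subtraction₁ : ∀ X Y K Z W → (+ X -ℤ + Y) *ℤ + K +ℤ + Z ≤ℤ + W → X * K + Z ≤ W + Y * K
clear-subtraction₁ X Y K Z W h = ℤP.drop‿+≤+ (subst₂ _≤ℤ_ lhs rhs (ℤP.+-monoˡ-≤ (+ Y *ℤ + K) h))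
  where
  open ≡-Reasoning
  cancel : ∀ x y k z → (x -ℤ y) *ℤ k +ℤ z +ℤ y *ℤ k ≡ x *ℤ k +ℤ z
  cancel = ℤ-solve-∀
  lhs : (+ X -ℤ + Y) *ℤ + K +ℤ + Z +ℤ + Y *ℤ + K ≡ + (X * K + Z)
  lhs = begin
    (+ X -ℤ + Y) *ℤ + K +ℤ + Z +ℤ + Y *ℤ + K ≡⟨ cancel (+ X) (+ Y) (+ K) (+ Z) ⟩
    + X *ℤ + K +ℤ + Z                        ≡⟨ cong (_+ℤ + Z) (ℤP.pos-* X K) ⟨
    + (X * K) +ℤ + Z                         ≡⟨ ℤP.pos-+ (X * K) Z ⟨
    + (X * K + Z)                            ∎
  rhs : + W +ℤ + Y *ℤ + K ≡ + (W + Y * K)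
  rhs = trans (cong (+ W +ℤ_) (sym (ℤP.pos-* Y K))) (sym (ℤP.pos-+ W (Y * K)))

clear-subtraction₂ : ∀ X Y K A B R W → (+ X -ℤ + Y) *ℤ + K +ℤ (+ A -ℤ + B) *ℤ + R ≤ℤ + W →
  X * K + A * R ≤ W + (Y * K + B * R)
clear-subtraction₂ X Y K A B R W h =
  ℤP.drop‿+≤+ (subst₂ _≤ℤ_ lhs rhs (ℤP.+-monoˡ-≤ (+ Y *ℤ + K +ℤ + B *ℤ + R) h))
  where
  open ≡-Reasoning
  cancel : ∀ x y k a b r → (x -ℤ y) *ℤ k +ℤ (a -ℤ b) *ℤ r +ℤ (y *ℤ k +ℤ b *ℤ r) ≡ x *ℤ k +ℤ a *ℤ r
  cancel = ℤ-solve-∀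
  lhs : (+ X -ℤ + Y) *ℤ + K +ℤ (+ A -ℤ + B) *ℤ + R +ℤ (+ Y *ℤ + K +ℤ + B *ℤ + R) ≡ + (X * K + A * R)
  lhs = begin
    (+ X -ℤ + Y) *ℤ + K +ℤ (+ A -ℤ + B) *ℤ + R +ℤ (+ Y *ℤ + K +ℤ + B *ℤ + R)
                                  ≡⟨ cancel (+ X) (+ Y) (+ K) (+ A) (+ B) (+ R) ⟩
    + X *ℤ + K +ℤ + A *ℤ + R      ≡⟨ cong₂ _+ℤ_ (ℤP.pos-* X K) (ℤP.pos-* A R) ⟨
    + (X * K) +ℤ + (A * R)        ≡⟨ ℤP.pos-+ (X * K) (A * R) ⟨
    + (X * K + A * R)             ∎
  rhs : + W +ℤ (+ Y *ℤ + K +ℤ + B *ℤ + R) ≡ + (W + (Y * K + B * R))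
  rhs = begin
    + W +ℤ (+ Y *ℤ + K +ℤ + B *ℤ + R)
                                           ≡⟨ cong (λ x → + W +ℤ x) (cong₂ _+ℤ_ (ℤP.pos-* Y K) (ℤP.pos-* B R)) ⟨
    + W +ℤ (+ (Y * K) +ℤ + (B * R))        ≡⟨ cong (λ x → + W +ℤ x) (ℤP.pos-+ (Y * K) (B * R)) ⟨
    + W +ℤ + (Y * K + B * R)               ≡⟨ ℤP.pos-+ W _ ⟨
    + (W + (Y * K + B * R))                ∎

low-hypothesis : ∀ a b m t n → 0 < a + b →
  (+ (a * b * m) -ℤ + (a + b * t)) *ℤ + (m * (a + b)) +ℤ + ((b * m + t) * (a + b)) ≤ℤ + (n * (a + b)) →
  a * b * m * m + b * m + t ≤ n + (a + b * t) * m
low-hypothesis a b m t n 0<R h =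
  *-cancelʳ-≤ _ _ (a + b) {{>-nonZero 0<R}} (subst₂ _≤_ (lhs a b m t) (rhs n a b t m)
    (clear-subtraction₁ (a * b * m) (a + b * t) (m * (a + b)) ((b * m + t) * (a + b)) (n * (a + b)) h))
  where
  lhs : ∀ a b m t → a * b * m * (m * (a + b)) + (b * m + t) * (a + b) ≡ (a * b * m * m + b * m + t) * (a + b)
  lhs = solve-∀
  rhs : ∀ n a b t m → n * (a + b) + (a + b * t) * (m * (a + b)) ≡ (n + (a + b * t) * m) * (a + b)
  rhs = solve-∀

high-hypothesis : ∀ a b m t n → 0 < a + b →
  (+ (a * b * m) -ℤ + (a + a * (a + b ∸ t))) *ℤ + (m * (a + b)) +ℤ (+ (b * m) -ℤ + (a + b ∸ t)) *ℤ + (a + b)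
    ≤ℤ + (n * (a + b)) →
  a * b * m * m + b * m ≤ n + ((a + a * (a + b ∸ t)) * m + (a + b ∸ t))
high-hypothesis a b m t n 0<R h =
  *-cancelʳ-≤ _ _ (a + b) {{>-nonZero 0<R}} (subst₂ _≤_ (lhs a b m) (rhs n a m (a + b) (a + b ∸ t))
    (clear-subtraction₂ (a * b * m) (a + a * (a + b ∸ t)) (m * (a + b)) (b * m) (a + b ∸ t) (a + b) (n * (a + b)) h))
  where
  lhs : ∀ a b m → a * b * m * (m * (a + b)) + b * m * (a + b) ≡ (a * b * m * m + b * m) * (a + b)
  lhs = solve-∀
  rhs : ∀ n a m R T → n * R + ((a + a * T) * (m * R) + T * R) ≡ (n + ((a + a * T) * m + T)) * R
  rhs = solve-∀

divisor-quotient : ∀ {R x t} → 1 ≤ x → R ∣ (x ∸ 1 + t) → ∃[ c ] x + t ≡ suc (c * R)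
divisor-quotient {x = suc x} _ (divides c eq) = c , cong suc eq

bounds-contradict-thresholds : ∀ a b m t n q p w → q ≤ a * p → suc q ≤ b * w →
  m ≡ p + w → n ≡ (q * m + p) * (a + b) → (a + b) ∣ (b * m ∸ 1 + t) → t < a + b →
  (t ≤ a → a * b * m * m + b * m + t ≤ n + (a + b * t) * m) →
  (a < t → a * b * m * m + b * m ≤ n + ((a + a * (a + b ∸ t)) * m + (a + b ∸ t))) → ⊥
bounds-contradict-thresholds a b m t n q p w q≤ap q<bw refl refl R∣ t<R low high = refute (divisor-quotient 1≤bm R∣)
  where
  1≤bm : 1 ≤ b * (p + w)
  1≤bm = ≤-trans (≤-trans (s≤s z≤n) q<bw) (*-monoʳ-≤ b (m≤n+m w p))
  0<m : 0 < p + w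
  0<m = >-nonZero⁻¹ (p + w) {{m*n≢0⇒n≢0 b {{>-nonZero 1≤bm}}}}
  refute : ∃[ c ] b * (p + w) + t ≡ suc (c * (a + b)) → ⊥
  refute (c , bm+t≡) with counterexample-length a b q p w t c q≤ap q<bw bm+t≡ | t ≤? a
  ... | bound | yes t≤a = <⇒≱ (low-threshold-exceeds t≤a bound) (low t≤a)
  ... | bound | no  t≰a = <⇒≱ (high-threshold-exceeds {n = (q * (p + w) + p) * (a + b)}
                                  (m∸n+n≡m (<⇒≤ t<R)) (≰⇒> t≰a) 0<m bound)
                                (high (≰⇒> t≰a))

positive-windows-impossible : ∀ {a b n f R P} k m t q p w → 0 < b → TwoValued a b n f → sumTo f n ≡ 0ℤ →
  R ≡ a + b → P ≡ a * b → k ≡ m * R → k ≤ n → m ≡ p + w → n ≡ (q * m + p) * R →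
  R ∣ (b * m ∸ 1 + t) → t < R →
  (t ≤ a → (+ (P * m) -ℤ + (a + b * t)) *ℤ + k +ℤ + ((b * m + t) * R) ≤ℤ + (n * R)) →
  (a < t → (+ (P * m) -ℤ + (a + a * (R ∸ t))) *ℤ + k +ℤ (+ (b * m) -ℤ + (R ∸ t)) *ℤ + R ≤ℤ + (n * R)) →
  ¬ (∀ x → x + k ≤ n → 0ℤ <ℤ blockSum f x k)
positive-windows-impossible {a} {b} {n} k m t q p w 0<b two sum≡0 refl refl refl k≤n m≡p+w n≡ R∣ t<R
                            low high positive
  with q≤ap , q<bw ← positive-windows⇒bounds m q p w 0<b two sum≡0 m≡p+w n≡ k≤n positive =
  bounds-contradict-thresholds a b m t n q p w q≤ap q<bw m≡p+w n≡ R∣ t<R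
    (low-hypothesis a b m t n 0<R ∘ low) (high-hypothesis a b m t n 0<R ∘ high)
  where
  0<R : 0 < a + b
  0<R = ≤-trans 0<b (m≤n+m b a)

theorem2p14 : (r s k m t t′ n : ℕ) →
    0 < r → 0 < s → 0 < k → r < s → gcd r s ≡ 1 →
    k ≡ m * (r + s) →
    t < r + s → (r + s) ∣ (s * m ∸ 1 + t) →
    t′ < r + s → (r + s) ∣ (r * m ∸ 1 + t′) →
    k ≤ n →
    (t ≤ r →
      ((+ (r * s * m) -ℤ + (r + s * t)) *ℤ + k) +ℤ + ((s * m + t) * (r + s))
        ≤ℤ + (n * (r + s))) →
    (r < t →
      ((+ (r * s * m) -ℤ + (r + r * (r + s ∸ t))) *ℤ + k)
        +ℤ (+ (s * m) -ℤ + (r + s ∸ t)) *ℤ + (r + s)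
        ≤ℤ + (n * (r + s))) →
    (t′ ≤ s →
      ((+ (r * s * m) -ℤ + (s + r * t′)) *ℤ + k) +ℤ + ((r * m + t′) * (r + s))
        ≤ℤ + (n * (r + s))) →
    (s < t′ →
      ((+ (r * s * m) -ℤ + (s + s * (r + s ∸ t′))) *ℤ + k)
        +ℤ (+ (r * m) -ℤ + (r + s ∸ t′)) *ℤ + (r + s)
        ≤ℤ + (n * (r + s))) →
    (f : ℕ → ℤ) →
    (∀ i → 1 ≤ i → i ≤ n → f i ≡ - (+ r) ⊎ f i ≡ + s) →
    sumTo f n ≡ 0ℤ →
    ∃[ a ] (a + k ≤ n × blockSum f a k ≡ 0ℤ)
theorem2p14 r s .(m * (r + s)) m t t′ n 0<r 0<s 0<k _ gcd≡1 refl t<R R∣₁ t′<R R∣₂ k≤n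
            h₁ h₂ h₃ h₄ f two sum≡0
  with q , p , w , m≡p+w , n≡ ← block-decomposition m 0<k (length-divisible 0<s gcd≡1 two sum≡0)
  with window-trichotomy m 0<s two k≤n
... | inj₁ zero-block = zero-block
... | inj₂ (inj₁ positive) = ⊥-elim (positive-windows-impossible _ m t q p w 0<s two sum≡0
        refl refl refl k≤n m≡p+w n≡ R∣₁ t<R h₁ h₂ positive)
... | inj₂ (inj₂ negative) = ⊥-elim (positive-windows-impossible _ m t′ q p w 0<r (TwoValued-neg two)
        (trans (blockSum-neg f 0 n) (cong -_ sum≡0))
        (+-comm r s) (*-comm r s) refl k≤n m≡p+w n≡ R∣₂ t′<R h₃ h₄
        (λ x x+k≤n → subst (0ℤ <ℤ_) (sym (blockSum-neg f x (m * (r + s)))) (ℤP.neg-mono-< (negative x x+k≤n))))
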